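{- For integers $n\geq 3$ and $m\geq 1$, $$\chi_\rho(FSSD_m(C_n)) = \begin{cases} 3, & n \text{ even},\\ 4, & n \text{ odd},\end{cases}$$ where $C_n$ is the cycle on $n$ vertices.
   Context: All graphs are finite and simple. For a positive integer $i$, an $i$-packing is a set of vertices in which any two distinct vertices are at distance greater than $i$. The packing chromatic number $\chi_\rho(H)$ of a graph $H$ is the smallest integer $k$ such that $V(H)$ can be partitioned into sets $V_1,\dots,V_k$ with each $V_i$ an $i$-packing. For a positive integer $m$, the finite super subdivision graph $FSSD_m(G)$ is obtained from $G$ by replacing each edge $uv$ of $G$ by a complete bipartite graph $K_{2,m}$ whose part of size $2$ is $\{u,v\}$; that is, the edge $uv$ is deleted and $m$ new vertices are added, each adjacent exactly to $u$ and $v$. -}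

module Defs where

open import Data.Nat using (ℕ; zero; suc; _≤_; _<_)
open import Data.Nat.DivMod using (_mod_)
open import Data.Fin using (Fin; toℕ; fromℕ<) renaming (_<_ to _<ᶠ_)
open import Data.Product using (Σ; _×_; _,_; ∃)
open import Data.Sum using (_⊎_)
open import Relation.Binary.PropositionalEquality using (_≡_; _≢_)
open import Relation.Nullary using (¬_)

-- Simplicity (symmetry, irreflexivity) is not stored; the only instance used, C_n
-- with n ≥ 3, is symmetric by definition and loopless.
record Graph : Set₁ where
  field
    N     : ℕ
    Adj   : Fin N → Fin N → Set

record GraphOn (V : Set) : Set₁ where
  field
    Adj : V → V → Set

data Walk {V : Set} (G : GraphOn V) : V → V → ℕ → Set where
  here : ∀ {u} → Walk G u u zero
  step : ∀ {u v w k} → GraphOn.Adj G u v → Walk G v w k → Walk G u w (suc k)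

DistLe : {V : Set} → GraphOn V → V → V → ℕ → Set
DistLe G u v i = ∃ λ k → k ≤ i × Walk G u v k

IsPacking : {V : Set} → GraphOn V → ℕ → (V → Set) → Set
IsPacking G i S = ∀ u v → S u → S v → u ≢ v → ¬ DistLe G u v i

-- Partition of V into V_1, …, V_k (colour c(v) = j ∈ Fin k means v ∈ V_{j+1}),
-- each V_i an i-packing.
PackingColouring : {V : Set} → GraphOn V → ℕ → Set
PackingColouring {V} G k =
  Σ (V → Fin k) λ c → ∀ (j : Fin k) → IsPacking G (suc (toℕ j)) (λ v → c v ≡ j)

PackingChromaticNumberIs : {V : Set} → GraphOn V → ℕ → Set
PackingChromaticNumberIs G k =
  PackingColouring G k × (∀ k' → k' < k → ¬ PackingColouring G k')

toOn : (G : Graph) → GraphOn (Fin (Graph.N G))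
toOn G = record { Adj = Graph.Adj G }

Edge : Graph → Set
Edge G = Σ (Fin (Graph.N G)) λ u → Σ (Fin (Graph.N G)) λ v → u <ᶠ v × Graph.Adj G u v

-- Finite super subdivision FSSD_m(G): vertices of G plus m new vertices per edge;
-- original edges are deleted, each new vertex (e , t) with e = uv is adjacent to u and v.
data FSSDAdj (G : Graph) (m : ℕ) : (Fin (Graph.N G) ⊎ (Edge G × Fin m)) →
                                   (Fin (Graph.N G) ⊎ (Edge G × Fin m)) → Set where
  old-new-l : ∀ u v (p : u <ᶠ v) (a : Graph.Adj G u v) (t : Fin m) →
              FSSDAdj G m (_⊎_.inj₁ u) (_⊎_.inj₂ ((u , v , p , a) , t))
  old-new-r : ∀ u v (p : u <ᶠ v) (a : Graph.Adj G u v) (t : Fin m) →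
              FSSDAdj G m (_⊎_.inj₁ v) (_⊎_.inj₂ ((u , v , p , a) , t))
  new-old-l : ∀ u v (p : u <ᶠ v) (a : Graph.Adj G u v) (t : Fin m) →
              FSSDAdj G m (_⊎_.inj₂ ((u , v , p , a) , t)) (_⊎_.inj₁ u)
  new-old-r : ∀ u v (p : u <ᶠ v) (a : Graph.Adj G u v) (t : Fin m) →
              FSSDAdj G m (_⊎_.inj₂ ((u , v , p , a) , t)) (_⊎_.inj₁ v)

FSSD : (m : ℕ) → (G : Graph) → GraphOn (Fin (Graph.N G) ⊎ (Edge G × Fin m))
FSSD m G = record { Adj = FSSDAdj G m }

sucMod : (n : ℕ) → Fin n → ℕ
sucMod zero ()
sucMod (suc n) i = toℕ (suc (toℕ i) mod suc n)

Cycle : ℕ → Graph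
Cycle n = record
  { N = n
  ; Adj = λ i j → (sucMod n i ≡ toℕ j) ⊎ (sucMod n j ≡ toℕ i)
  }

-- Colour every subdivision vertex 1 and the cycle vertices
-- 2,3,2,3,… (for odd n, vertex 0 gets colour 4 instead).  This is a packing
-- colouring of FSSD_m(G) for ANY graph G as soon as the colouring of G is proper,
-- avoids colour 1 and uses colours ≥ 4 at most once: two subdivision vertices are
-- never adjacent, and two original vertices at distance ≤ 3 are at distance 2,
-- i.e. adjacent in G.
--
-- Walking around the cycle through one subdivision vertex per edge
-- gives a closed walk of length 2n whose vertices at distance 1, 2, 3 along it are
-- distinct ("path-like").  A packing colouring restricted to such a walk colours a
-- path: with two colours already four consecutive vertices are impossible; with
-- three colours, from position 2 on colour 1 occupies every other position and the
-- remaining positions alternate 2,3.  So the colours can repeat after 2n steps only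
-- if n is even.

module Submission where

open import Defs
open import Data.Nat using (ℕ; _≤_; _%_)
open import Relation.Binary.PropositionalEquality using (_≡_)
open import Data.Product using (_×_)

open import Data.Bool.Base using (T)
open import Data.Empty using (⊥; ⊥-elim)
open import Data.Fin using (Fin; zero; suc; toℕ; inject≤)
open import Data.Fin.Properties
  using (toℕ-injective; toℕ<n; toℕ-fromℕ<; toℕ-inject≤; inject≤-injective; <-cmp)
import Data.Fin.Properties as Fin
open import Data.Nat using (zero; suc; _+_; _*_; _<_; _<ᵇ_; _≤?_; z≤n; s≤s; NonZero; >-nonZero)
open import Data.Nat.Properties
  using (≤-trans; ≤-pred; ≰⇒>; <⇒<ᵇ; <⇒≱; n≤1+n; +-suc; +-comm; +-assoc;
         +-cancelˡ-≡; m≤n⇒m<n∨m≡n; +-commutativeSemigroup)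
open import Data.Nat.DivMod
  using (_mod_; _/_; m≡m%n+[m/n]*n; m<n⇒m%n≡m; n%n≡0; %-distribˡ-+; m%n%n≡m%n; [m+n]%n≡m%n)
open import Data.Nat.Divisibility using (_∣_; divides; ∣m+n∣m⇒∣n; ∣⇒≤)
open import Data.Product using (Σ; _,_; proj₁; proj₂)
open import Data.Sum using (_⊎_; inj₁; inj₂)
open import Data.Sum.Properties using (inj₁-injective; inj₂-injective)
open import Function using (_∘_)
open import Algebra.Properties.CommutativeSemigroup +-commutativeSemigroup using (x∙yz≈y∙xz)
open import Relation.Binary.Definitions using (tri<; tri≈; tri>)
open import Relation.Binary.PropositionalEquality
  using (refl; sym; trans; cong; subst; _≢_; ≢-sym; module ≡-Reasoning)
open import Relation.Nullary using (¬_; yes; no)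

-- Colour j+1 is represented by j : Fin k; these name the first four colours.
pattern c₁ = zero
pattern c₂ = suc zero
pattern c₃ = suc (suc zero)
pattern c₄ = suc (suc (suc zero))

%-shift-≢ : ∀ n d k .{{_ : NonZero n}} → 0 < d → d < n → (d + k) % n ≢ k % n
%-shift-≢ n d k 0<d d<n eq = <⇒≱ d<n (∣⇒≤ {{>-nonZero 0<d}} n∣d)
  where
  open ≡-Reasoning
  same-remainder : k % n + (k / n * n + d) ≡ k % n + (d + k) / n * n
  same-remainder = begin
    k % n + (k / n * n + d)        ≡⟨ sym (+-assoc (k % n) _ d) ⟩
    k % n + k / n * n + d          ≡⟨ cong (_+ d) (sym (m≡m%n+[m/n]*n k n)) ⟩
    k + d                          ≡⟨ +-comm k d ⟩
    d + k                          ≡⟨ m≡m%n+[m/n]*n (d + k) n ⟩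
    (d + k) % n + (d + k) / n * n  ≡⟨ cong (_+ (d + k) / n * n) eq ⟩
    k % n + (d + k) / n * n        ∎
  n∣d : n ∣ d
  n∣d = ∣m+n∣m⇒∣n (divides ((d + k) / n) (+-cancelˡ-≡ (k % n) _ _ same-remainder))
                  (divides (k / n) refl)

suc-% : ∀ k n .{{_ : NonZero n}} → suc (k % n) % n ≡ suc k % n
suc-% k n = begin
  (1 + k % n) % n          ≡⟨ %-distribˡ-+ 1 (k % n) n ⟩
  (1 % n + k % n % n) % n  ≡⟨ cong (λ r → (1 % n + r) % n) (m%n%n≡m%n k n) ⟩
  (1 % n + k % n) % n      ≡⟨ sym (%-distribˡ-+ 1 k n) ⟩
  (1 + k) % n              ∎
  where open ≡-Reasoning

suc-%-cases : ∀ n t .{{_ : NonZero n}} → t < n →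
              suc t % n ≡ suc t ⊎ (suc t ≡ n × suc t % n ≡ 0)
suc-%-cases n t t<n with m≤n⇒m<n∨m≡n t<n
... | inj₁ 1+t<n = inj₁ (m<n⇒m%n≡m 1+t<n)
... | inj₂ 1+t≡n = inj₂ (1+t≡n , trans (cong (_% n) 1+t≡n) (n%n≡0 n))

-- Packing colourings of paths

-- Colours x and y on vertices at distance d are compatible with the packing
-- condition: if they are equal, the colour toℕ x + 1 is smaller than d.
Compatible : ∀ {k} → ℕ → Fin k → Fin k → Set
Compatible d x y = x ≡ y → T (suc (toℕ x) <ᵇ d)

record Window {k} (x₀ x₁ x₂ x₃ : Fin k) : Set where
  field
    gap₀₁ : Compatible 1 x₀ x₁
    gap₁₂ : Compatible 1 x₁ x₂
    gap₂₃ : Compatible 1 x₂ x₃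
    gap₀₂ : Compatible 2 x₀ x₂
    gap₁₃ : Compatible 2 x₁ x₃
    gap₀₃ : Compatible 3 x₀ x₃
open Window

-- A colouring of the infinite path 0,1,2,… respecting the packing condition
-- (for colours 1, 2, 3, which only see distances up to 3).
PathColouring : ∀ {k} → (ℕ → Fin k) → Set
PathColouring a = ∀ q → Window (a q) (a (1 + q)) (a (2 + q)) (a (3 + q))

apartAtTwo : ∀ {k} {x y : Fin (suc k)} → x ≢ c₁ → Compatible 2 x y → x ≢ y
apartAtTwo {x = zero}  x≢1 _   = ⊥-elim (x≢1 refl)
apartAtTwo {x = suc _} _   gap = gap

noWindow₂ : (x₀ x₁ x₂ x₃ : Fin 2) → ¬ Window x₀ x₁ x₂ x₃
noWindow₂ c₁ c₁ _  _  w = gap₀₁ w refl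
noWindow₂ c₂ c₂ _  _  w = gap₀₁ w refl
noWindow₂ _  c₂ c₂ _  w = gap₁₂ w refl
noWindow₂ c₂ c₁ c₁ _  w = gap₁₂ w refl
noWindow₂ c₂ c₁ c₂ _  w = gap₀₂ w refl
noWindow₂ c₁ c₂ c₁ c₁ w = gap₂₃ w refl
noWindow₂ c₁ c₂ c₁ c₂ w = gap₁₃ w refl

threeTwoBlocked : (x₂ x₃ : Fin 3) → ¬ Window c₃ c₂ x₂ x₃
threeTwoBlocked c₂ _  w = gap₁₂ w refl
threeTwoBlocked c₃ _  w = gap₀₂ w refl
threeTwoBlocked c₁ c₁ w = gap₂₃ w refl
threeTwoBlocked c₁ c₂ w = gap₁₃ w refl
threeTwoBlocked c₁ c₃ w = gap₀₃ w refl

twoThreeBlocked : (x₀ x₁ : Fin 3) → ¬ Window x₀ x₁ c₂ c₃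
twoThreeBlocked _  c₂ w = gap₁₂ w refl
twoThreeBlocked _  c₃ w = gap₁₃ w refl
twoThreeBlocked c₁ c₁ w = gap₀₁ w refl
twoThreeBlocked c₂ c₁ w = gap₀₂ w refl
twoThreeBlocked c₃ c₁ w = gap₀₃ w refl

middleHasOne : (x₀ x₁ x₂ x₃ x₄ x₅ : Fin 3) → Window x₀ x₁ x₂ x₃ → Window x₂ x₃ x₄ x₅ →
               x₂ ≡ c₁ ⊎ x₃ ≡ c₁
middleHasOne _  _  c₁ _  _  _  _ _ = inj₁ refl
middleHasOne _  _  _  c₁ _  _  _ _ = inj₂ refl
middleHasOne _  _  c₂ c₂ _  _  _ w = ⊥-elim (gap₀₁ w refl)
middleHasOne _  _  c₃ c₃ _  _  _ w = ⊥-elim (gap₀₁ w refl)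
middleHasOne _  _  c₃ c₂ x₄ x₅ _ w = ⊥-elim (threeTwoBlocked x₄ x₅ w)
middleHasOne x₀ x₁ c₂ c₃ _  _  w _ = ⊥-elim (twoThreeBlocked x₀ x₁ w)

twoApart : (x y z : Fin 3) → x ≢ c₁ → y ≢ c₁ → z ≢ c₁ → y ≢ x → z ≢ y → z ≡ x
twoApart c₁ _  _  x≢1 _   _   _   _   = ⊥-elim (x≢1 refl)
twoApart _  c₁ _  _   y≢1 _   _   _   = ⊥-elim (y≢1 refl)
twoApart _  _  c₁ _   _   z≢1 _   _   = ⊥-elim (z≢1 refl)
twoApart c₂ c₂ _  _   _   _   y≢x _   = ⊥-elim (y≢x refl)
twoApart c₃ c₃ _  _   _   _   y≢x _   = ⊥-elim (y≢x refl)
twoApart _  c₂ c₂ _   _   _   _   z≢y = ⊥-elim (z≢y refl)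
twoApart _  c₃ c₃ _   _   _   _   z≢y = ⊥-elim (z≢y refl)
twoApart c₂ c₃ c₂ _   _   _   _   _   = refl
twoApart c₃ c₂ c₃ _   _   _   _   _   = refl

oddStepsDiffer : (e : ℕ → Fin 3) → (∀ j → e j ≢ c₁) → (∀ j → e (suc j) ≢ e j) →
                 ∀ j → j % 2 ≡ 1 → e j ≢ e 0
oddStepsDiffer e nonOne changes zero          ()
oddStepsDiffer e nonOne changes (suc zero)    _   = changes 0
oddStepsDiffer e nonOne changes (suc (suc j)) odd ej+2≡e0 =
  oddStepsDiffer e nonOne changes j odd (trans (sym ej+2≡ej) ej+2≡e0)
  where
  ej+2≡ej : e (suc (suc j)) ≡ e j
  ej+2≡ej = twoApart (e j) (e (suc j)) (e (suc (suc j)))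
              (nonOne j) (nonOne (suc j)) (nonOne (suc (suc j))) (changes j) (changes (suc j))

module OddPeriod {p : ℕ} (a : ℕ → Fin 3) (pathCol : PathColouring a)
                 (periodic : ∀ q → a (p * 2 + q) ≡ a q) (odd : p % 2 ≡ 1) where

  oneInPair : ∀ s → a (2 + s) ≡ c₁ ⊎ a (3 + s) ≡ c₁
  oneInPair s = middleHasOne _ _ _ _ _ _ (pathCol s) (pathCol (2 + s))

  nonOneAgain : ∀ s → a (2 + s) ≢ c₁ → a (4 + s) ≢ c₁
  nonOneAgain s a₂≢1 a₄≡1 with oneInPair s
  ... | inj₁ a₂≡1 = a₂≢1 a₂≡1
  ... | inj₂ a₃≡1 = gap₀₁ (pathCol (3 + s)) (trans a₃≡1 (sym a₄≡1))

  -- Starting from a position r + 2 coloured 2 or 3, every second position is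
  -- coloured 2 or 3 and these colours alternate, contradicting the odd period.
  fromNonOne : ∀ r → a (2 + r) ≢ c₁ → ⊥
  fromNonOne r a₂≢1 = oddStepsDiffer e nonOne changes p odd back
    where
    e : ℕ → Fin 3
    e j = a (2 + (j * 2 + r))
    nonOne : ∀ j → e j ≢ c₁
    nonOne zero    = a₂≢1
    nonOne (suc j) = nonOneAgain (j * 2 + r) (nonOne j)
    changes : ∀ j → e (suc j) ≢ e j
    changes j = ≢-sym (apartAtTwo (nonOne j) (gap₀₂ (pathCol (2 + (j * 2 + r)))))
    back : e p ≡ e 0
    back = trans (cong a (x∙yz≈y∙xz 2 (p * 2) r)) (periodic (2 + r))

  -- Positions 2 and 3 have different colours, so one of them is not 1.
  impossible : ⊥
  impossible with a 2 Fin.≟ c₁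
  ... | no  a₂≢1 = fromNonOne 0 a₂≢1
  ... | yes a₂≡1 = fromNonOne 1 (λ a₃≡1 → gap₀₁ (pathCol 2) (trans a₂≡1 (sym a₃≡1)))

noOddPeriodicPathColouring₃ : ∀ {p} (a : ℕ → Fin 3) → PathColouring a →
  (∀ q → a (p * 2 + q) ≡ a q) → p % 2 ≡ 1 → ⊥
noOddPeriodicPathColouring₃ {p} a pathCol periodic odd =
  OddPeriod.impossible {p} a pathCol periodic odd

widen : ∀ {V : Set} {G : GraphOn V} {k' k} → k' ≤ k →
        PackingColouring G k' → PackingColouring G k
widen {V} {G} {k = k} k'≤k (c , packing) = c' , packing'
  where
  c' : V → Fin k
  c' v = inject≤ (c v) k'≤k
  packing' : ∀ j → IsPacking G (suc (toℕ j)) (λ v → c' v ≡ j)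
  packing' j u v u∈j v∈j u≢v dist =
    packing (c u) u v refl (inject≤-injective k'≤k k'≤k (c v) (c u) (trans v∈j (sym u∈j))) u≢v
      (subst (λ i → DistLe G u v (suc i)) (trans (cong toℕ (sym u∈j)) (toℕ-inject≤ (c u) k'≤k)) dist)

fewerImpossible : ∀ {V : Set} {G : GraphOn V} {k} → ¬ PackingColouring G k →
                  ∀ k' → k' < suc k → ¬ PackingColouring G k'
fewerImpossible none k' k'<1+k col = none (widen (≤-pred k'<1+k) col)

record PathLike {V : Set} (G : GraphOn V) (pos : ℕ → V) : Set where
  field
    adjacent  : ∀ q → GraphOn.Adj G (pos q) (pos (suc q))
    distinct₁ : ∀ q → pos q ≢ pos (1 + q)
    distinct₂ : ∀ q → pos q ≢ pos (2 + q)
    distinct₃ : ∀ q → pos q ≢ pos (3 + q)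

module _ {V : Set} {G : GraphOn V} {pos : ℕ → V} (path : PathLike G pos) where
  open PathLike path

  segment : ∀ d q → Walk G (pos q) (pos (d + q)) d
  segment zero    q = here
  segment (suc d) q = step (adjacent q)
    (subst (λ x → Walk G (pos (suc q)) (pos x) d) (+-suc d q) (segment d (suc q)))

  colourAlong : ∀ {k} ((c , _) : PackingColouring G k) → PathColouring (c ∘ pos)
  colourAlong (c , packing) q = record
    { gap₀₁ = compatible 1 q (distinct₁ q)
    ; gap₁₂ = compatible 1 (1 + q) (distinct₁ (1 + q))
    ; gap₂₃ = compatible 1 (2 + q) (distinct₁ (2 + q))
    ; gap₀₂ = compatible 2 q (distinct₂ q)
    ; gap₁₃ = compatible 2 (1 + q) (distinct₂ (1 + q))
    ; gap₀₃ = compatible 3 q (distinct₃ q)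
    }
    where
    compatible : ∀ d q → pos q ≢ pos (d + q) → Compatible d (c (pos q)) (c (pos (d + q)))
    compatible d q different same = <⇒<ᵇ (≰⇒> λ near →
      packing (c (pos q)) (pos q) (pos (d + q)) refl (sym same) different (d , near , segment d q))

  noPackingColouring₂ : ¬ PackingColouring G 2
  noPackingColouring₂ col = noWindow₂ _ _ _ _ (colourAlong col 0)

  noPackingColouring₃ : ∀ p → (∀ q → pos (p * 2 + q) ≡ pos q) → p % 2 ≡ 1 →
                        ¬ PackingColouring G 3
  noPackingColouring₃ p periodic odd col@(c , _) =
    noOddPeriodicPathColouring₃ {p} (c ∘ pos) (colourAlong col) (cong c ∘ periodic) odd

-- The finite super subdivision of a graph

module Subdivision (G : Graph) (m : ℕ) where
  open Graph G using (N; Adj)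

  Joins : Edge G → Fin N → Fin N → Set
  Joins (a , b , _) u v = (a ≡ u × b ≡ v) ⊎ (a ≡ v × b ≡ u)

  edgeJoining : ∀ {u v} → u ≢ v → Adj u v → Adj v u → Σ (Edge G) λ e → Joins e u v
  edgeJoining {u} {v} u≢v uv vu with <-cmp u v
  ... | tri< u<v _ _ = (u , v , u<v , uv) , inj₁ (refl , refl)
  ... | tri≈ _ u≡v _ = ⊥-elim (u≢v u≡v)
  ... | tri> _ _ v<u = (v , u , v<u , vu) , inj₂ (refl , refl)

  joins-left : ∀ {e u v} (t : Fin m) → Joins e u v → FSSDAdj G m (inj₁ u) (inj₂ (e , t))
  joins-left {a , b , a<b , ab} t (inj₁ (refl , refl)) = old-new-l a b a<b ab t
  joins-left {a , b , a<b , ab} t (inj₂ (refl , refl)) = old-new-r a b a<b ab t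

  joins-right : ∀ {e u v} (t : Fin m) → Joins e u v → FSSDAdj G m (inj₂ (e , t)) (inj₁ v)
  joins-right {a , b , a<b , ab} t (inj₁ (refl , refl)) = new-old-r a b a<b ab t
  joins-right {a , b , a<b , ab} t (inj₂ (refl , refl)) = new-old-l a b a<b ab t

  joins-unique : ∀ {e u v w} → Joins e u v → Joins e v w → u ≡ v ⊎ u ≡ w
  joins-unique {_ , _ , _} (inj₁ (refl , refl)) (inj₁ (refl , refl)) = inj₁ refl
  joins-unique {_ , _ , _} (inj₁ (refl , refl)) (inj₂ (refl , refl)) = inj₂ refl
  joins-unique {_ , _ , _} (inj₂ (refl , refl)) (inj₁ (refl , refl)) = inj₂ refl
  joins-unique {_ , _ , _} (inj₂ (refl , refl)) (inj₂ (refl , refl)) = inj₁ refl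

  newNew : ∀ {x y d} → Walk (FSSD m G) (inj₂ x) (inj₂ y) d → d ≤ 1 → x ≡ y
  newNew here                _        = refl
  newNew (step () here)      _
  newNew (step _ (step _ _)) (s≤s ())

  -- Original vertices at distance ≤ 3 in FSSD_m(G) are equal or adjacent in G
  -- (odd walks between original vertices do not exist).
  oldOld : ∀ {u v d} → Walk (FSSD m G) (inj₁ u) (inj₁ v) d → d ≤ 3 →
           u ≡ v ⊎ Adj u v ⊎ Adj v u
  oldOld here _ = inj₁ refl
  oldOld (step () here) _
  oldOld (step (old-new-l _ _ _ _  _) (step (new-old-l _ _ _ _ _) here)) _ = inj₁ refl
  oldOld (step (old-new-l _ _ _ uv _) (step (new-old-r _ _ _ _ _) here)) _ = inj₂ (inj₁ uv)
  oldOld (step (old-new-r _ _ _ vu _) (step (new-old-l _ _ _ _ _) here)) _ = inj₂ (inj₂ vu)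
  oldOld (step (old-new-r _ _ _ _  _) (step (new-old-r _ _ _ _ _) here)) _ = inj₁ refl
  oldOld (step _ (step (new-old-l _ _ _ _ _) (step () here))) _
  oldOld (step _ (step (new-old-r _ _ _ _ _) (step () here))) _
  oldOld (step _ (step _ (step _ (step _ _)))) (s≤s (s≤s (s≤s ())))

  extend : ∀ {k} → (Fin N → Fin (suc k)) → Fin N ⊎ (Edge G × Fin m) → Fin (suc k)
  extend f (inj₁ u) = f u
  extend f (inj₂ _) = c₁

  extend-packing : ∀ {k} (f : Fin N → Fin (suc k)) → (∀ u → f u ≢ c₁) →
    (∀ u v → Adj u v → f u ≢ f v) → (∀ u v → f u ≡ f v → 3 ≤ toℕ (f u) → u ≡ v) →
    PackingColouring (FSSD m G) (suc k)
  extend-packing f nonOne proper unique = extend f , packing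
    where
    packing : ∀ j → IsPacking (FSSD m G) (suc (toℕ j)) (λ v → extend f v ≡ j)
    packing j (inj₂ x) (inj₂ y) refl _ x≢y (_ , d≤1 , w) = x≢y (cong inj₂ (newNew w d≤1))
    packing j (inj₁ u) (inj₂ _) u∈j 1∈j _ _ = nonOne u (trans u∈j (sym 1∈j))
    packing j (inj₂ _) (inj₁ v) 1∈j v∈j _ _ = nonOne v (trans v∈j (sym 1∈j))
    packing j (inj₁ u) (inj₁ v) u∈j v∈j u≢v (_ , d≤ , w) with toℕ j ≤? 2
    ... | yes j≤2 with oldOld w (≤-trans d≤ (s≤s j≤2))
    ...   | inj₁ u≡v        = u≢v (cong inj₁ u≡v)
    ...   | inj₂ (inj₁ uv)  = proper u v uv (trans u∈j (sym v∈j))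
    ...   | inj₂ (inj₂ vu)  = proper v u vu (trans v∈j (sym u∈j))
    packing j (inj₁ u) (inj₁ v) u∈j v∈j u≢v _ | no j≰2 =
      u≢v (cong inj₁ (unique u v (trans u∈j (sym v∈j)) (subst (λ c → 3 ≤ toℕ c) (sym u∈j) (≰⇒> j≰2))))

alternating : ∀ {k} → ℕ → Fin (3 + k)
alternating zero          = c₂
alternating (suc zero)    = c₃
alternating (suc (suc t)) = alternating t

alternating-nonOne : ∀ {k} t → alternating {k} t ≢ c₁
alternating-nonOne zero          ()
alternating-nonOne (suc zero)    ()
alternating-nonOne (suc (suc t)) = alternating-nonOne t

alternating-changes : ∀ {k} t → alternating {k} t ≢ alternating (suc t)
alternating-changes zero          ()
alternating-changes (suc zero)    ()
alternating-changes (suc (suc t)) = alternating-changes t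

alternating-small : ∀ {k} t → toℕ (alternating {k} t) < 3
alternating-small zero          = s≤s (s≤s z≤n)
alternating-small (suc zero)    = s≤s (s≤s (s≤s z≤n))
alternating-small (suc (suc t)) = alternating-small t

-- Just before an even position the colour is 3, so the colouring closes up
-- around an even cycle.
alternating-beforeEven : ∀ {k} t → suc t % 2 ≡ 0 → alternating {k} t ≡ c₃
alternating-beforeEven zero          ()
alternating-beforeEven (suc zero)    _    = refl
alternating-beforeEven (suc (suc t)) even = alternating-beforeEven t even

alternating-closes : ∀ {k} n → n % 2 ≡ 0 → ∀ t → suc t ≡ n → alternating {k} t ≢ alternating 0
alternating-closes _ even t refl same with trans (sym (alternating-beforeEven t even)) same
... | ()

withFour : ℕ → Fin 4
withFour zero    = c₄
withFour (suc t) = alternating (suc t)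

withFour-nonOne : ∀ t → withFour t ≢ c₁
withFour-nonOne zero    ()
withFour-nonOne (suc t) = alternating-nonOne (suc t)

withFour-changes : ∀ t → withFour t ≢ withFour (suc t)
withFour-changes zero    ()
withFour-changes (suc t) = alternating-changes (suc t)

withFour-closes : ∀ n → 1 < n → ∀ t → suc t ≡ n → withFour t ≢ withFour 0
withFour-closes _ 1<n zero    refl _    = <⇒≱ 1<n (s≤s z≤n)
withFour-closes _ _   (suc t) _    same =
  <⇒≱ (alternating-small (suc t)) (subst (λ c → 3 ≤ toℕ c) (sym same) (s≤s (s≤s (s≤s z≤n))))

withFour-fourOnlyAtZero : ∀ t → 3 ≤ toℕ (withFour t) → t ≡ 0
withFour-fourOnlyAtZero zero    _   = refl
withFour-fourOnlyAtZero (suc t) big = ⊥-elim (<⇒≱ (alternating-small (suc t)) big)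

interleave : {A : Set} → (ℕ → A) → (ℕ → A) → ℕ → A
interleave f g zero          = f 0
interleave f g (suc zero)    = g 0
interleave f g (suc (suc q)) = interleave (f ∘ suc) (g ∘ suc) q

module _ {A B : Set} (R : A → B → Set) where

  interleave-pointwise : ∀ {f g f′ g′} → (∀ k → R (f k) (f′ k)) → (∀ k → R (g k) (g′ k)) →
                         ∀ q → R (interleave f g q) (interleave f′ g′ q)
  interleave-pointwise ff gg zero          = ff 0
  interleave-pointwise ff gg (suc zero)    = gg 0
  interleave-pointwise ff gg (suc (suc q)) =
    interleave-pointwise (ff ∘ suc) (gg ∘ suc) q

  interleave-successive : ∀ {f g f′ g′} → (∀ k → R (f k) (g′ k)) → (∀ k → R (g k) (f′ (suc k))) →
                          ∀ q → R (interleave f g q) (interleave f′ g′ (suc q))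
  interleave-successive fg gf zero          = fg 0
  interleave-successive fg gf (suc zero)    = gf 0
  interleave-successive fg gf (suc (suc q)) =
    interleave-successive (fg ∘ suc) (gf ∘ suc) q

interleave-drop : {A : Set} (f g : ℕ → A) → ∀ k q →
                  interleave f g (k * 2 + q) ≡ interleave (λ i → f (k + i)) (λ i → g (k + i)) q
interleave-drop f g zero    q = refl
interleave-drop f g (suc k) q = interleave-drop (f ∘ suc) (g ∘ suc) k q

-- The subdivided cycle

module SubdividedCycle (N : ℕ) (3≤n : 3 ≤ suc N) {m : ℕ} (t₀ : Fin m) where
  n : ℕ
  n = suc N

  open Subdivision (Cycle n) m

  vertex : ℕ → Fin n
  vertex k = k mod n

  toℕ-vertex : ∀ k → toℕ (vertex k) ≡ k % n
  toℕ-vertex k = toℕ-fromℕ< _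

  vertex-≡ : ∀ a b → a % n ≡ b % n → vertex a ≡ vertex b
  vertex-≡ a b e = toℕ-injective (trans (toℕ-vertex a) (trans e (sym (toℕ-vertex b))))

  vertex-periodic : ∀ k → vertex (n + k) ≡ vertex k
  vertex-periodic k = vertex-≡ (n + k) k (trans (cong (_% n) (+-comm n k)) ([m+n]%n≡m%n k n))

  vertex-shift-≢ : ∀ d k → 0 < d → d < n → vertex (d + k) ≢ vertex k
  vertex-shift-≢ d k 0<d d<n e =
    %-shift-≢ n d k 0<d d<n (trans (sym (toℕ-vertex (d + k))) (trans (cong toℕ e) (toℕ-vertex k)))

  1<n : 1 < n
  1<n = ≤-trans (n≤1+n 2) 3≤n

  next : Fin n → Fin n
  next i = vertex (suc (toℕ i))

  next-vertex : ∀ k → next (vertex k) ≡ vertex (suc k)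
  next-vertex k = vertex-≡ (suc (toℕ (vertex k))) (suc k) (trans (cong (λ r → suc r % n) (toℕ-vertex k)) (suc-% k n))

  next-≢ : ∀ i → i ≢ next i
  next-≢ i i≡next = %-shift-≢ n 1 (toℕ i) (s≤s z≤n) 1<n
    (trans (sym (toℕ-vertex (suc (toℕ i))))
      (trans (cong toℕ (sym i≡next)) (sym (m<n⇒m%n≡m (toℕ<n i)))))

  edgeAfter : Fin n → Edge (Cycle n)
  edgeAfter i = proj₁ (edgeJoining (next-≢ i) (inj₁ refl) (inj₂ refl))

  midpoint : Fin n → Fin n ⊎ (Edge (Cycle n) × Fin m)
  midpoint i = inj₂ (edgeAfter i , t₀)

  joins-vertex : ∀ k → Joins (edgeAfter (vertex k)) (vertex k) (vertex (suc k))
  joins-vertex k = subst (Joins (edgeAfter (vertex k)) (vertex k)) (next-vertex k)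
    (proj₂ (edgeJoining (next-≢ (vertex k)) (inj₁ refl) (inj₂ refl)))

  -- Midpoints of consecutive edges differ, since n ≥ 3.
  midpoint-≢ : ∀ k → midpoint (vertex k) ≢ midpoint (vertex (suc k))
  midpoint-≢ k same with joins-unique {edgeAfter (vertex k)} (joins-vertex k)
    (subst (λ e → Joins e (vertex (suc k)) (vertex (2 + k)))
           (sym (cong (proj₁ {B = λ _ → Fin m}) (inj₂-injective same))) (joins-vertex (suc k)))
  ... | inj₁ k≡k+1 = vertex-shift-≢ 1 k (s≤s z≤n) 1<n (sym k≡k+1)
  ... | inj₂ k≡k+2 = vertex-shift-≢ 2 k (s≤s z≤n) 3≤n (sym k≡k+2)

  walk : ℕ → Fin n ⊎ (Edge (Cycle n) × Fin m)
  walk = interleave (inj₁ ∘ vertex) (midpoint ∘ vertex)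

  walk-pathLike : PathLike (FSSD m (Cycle n)) walk
  walk-pathLike = record
    { adjacent  = interleave-successive (FSSDAdj (Cycle n) m)
                    (λ k → joins-left t₀ (joins-vertex k)) (λ k → joins-right t₀ (joins-vertex k))
    ; distinct₁ = interleave-successive _≢_ (λ _ ()) (λ _ ())
    ; distinct₂ = interleave-pointwise _≢_
                    (λ k same → vertex-shift-≢ 1 k (s≤s z≤n) 1<n (sym (inj₁-injective same)))
                    midpoint-≢
    ; distinct₃ = interleave-successive _≢_ (λ _ ()) (λ _ ())
    }

  walk-periodic : ∀ q → walk (n * 2 + q) ≡ walk q
  walk-periodic q = trans (interleave-drop (inj₁ ∘ vertex) (midpoint ∘ vertex) n q)
    (interleave-pointwise _≡_ (cong inj₁ ∘ vertex-periodic) (cong midpoint ∘ vertex-periodic) q)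

  cycle-successor : (i j : Fin n) → sucMod n i ≡ toℕ j → toℕ j ≡ suc (toℕ i) % n
  cycle-successor i j i→j = trans (sym i→j) (toℕ-vertex (suc (toℕ i)))

  module _ {A : Set} (ψ : ℕ → A) (changes : ∀ t → ψ t ≢ ψ (suc t))
           (closes : ∀ t → suc t ≡ n → ψ t ≢ ψ 0) where

    changesToNext : (i j : Fin n) → sucMod n i ≡ toℕ j → ψ (toℕ i) ≢ ψ (toℕ j)
    changesToNext i j i→j same with suc-%-cases n (toℕ i) (toℕ<n i)
    ... | inj₁ noWrap        = changes (toℕ i) (trans same (cong ψ (trans (cycle-successor i j i→j) noWrap)))
    ... | inj₂ (last , wrap) = closes (toℕ i) last (trans same (cong ψ (trans (cycle-successor i j i→j) wrap)))

    cycle-proper : (i j : Fin n) → Graph.Adj (Cycle n) i j → ψ (toℕ i) ≢ ψ (toℕ j)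
    cycle-proper i j (inj₁ i→j) = changesToNext i j i→j
    cycle-proper i j (inj₂ j→i) = ≢-sym (changesToNext j i j→i)

  cycle-packing : ∀ {k} (ψ : ℕ → Fin (suc k)) → (∀ t → ψ t ≢ c₁) →
    (∀ t → ψ t ≢ ψ (suc t)) → (∀ t → suc t ≡ n → ψ t ≢ ψ 0) →
    (∀ t → 3 ≤ toℕ (ψ t) → t ≡ 0) → PackingColouring (FSSD m (Cycle n)) (suc k)
  cycle-packing ψ nonOne changes closes onlyAtZero =
    extend-packing (ψ ∘ toℕ) (nonOne ∘ toℕ) (cycle-proper ψ changes closes) unique
    where
    unique : ∀ u v → ψ (toℕ u) ≡ ψ (toℕ v) → 3 ≤ toℕ (ψ (toℕ u)) → u ≡ v
    unique u v same big = toℕ-injective (trans (onlyAtZero (toℕ u) big)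
      (sym (onlyAtZero (toℕ v) (subst (λ c → 3 ≤ toℕ c) same big))))

proposition7 : ∀ (n m : ℕ) → 3 ≤ n → 1 ≤ m →
    (n % 2 ≡ 0 → PackingChromaticNumberIs (FSSD m (Cycle n)) 3) ×
    (n % 2 ≡ 1 → PackingChromaticNumberIs (FSSD m (Cycle n)) 4)
proposition7 zero    _       ()  _
proposition7 (suc N) zero    _   ()
proposition7 (suc N) (suc m) 3≤n _ = evenCase , oddCase
  where
  open SubdividedCycle N 3≤n {suc m} zero

  evenCase : suc N % 2 ≡ 0 → PackingChromaticNumberIs (FSSD (suc m) (Cycle n)) 3
  evenCase even =
    cycle-packing alternating alternating-nonOne alternating-changes (alternating-closes n even)
      (λ t big → ⊥-elim (<⇒≱ (alternating-small t) big)) ,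
    fewerImpossible (noPackingColouring₂ walk-pathLike)

  oddCase : suc N % 2 ≡ 1 → PackingChromaticNumberIs (FSSD (suc m) (Cycle n)) 4
  oddCase odd =
    cycle-packing withFour withFour-nonOne withFour-changes (withFour-closes n 1<n)
      withFour-fourOnlyAtZero ,
    fewerImpossible (noPackingColouring₃ walk-pathLike n walk-periodic odd)
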